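{- Let $\Pi\le\Gamma$ be a subgroup of order $2$ that fixes $S$ setwise, let $\Delta$ be the restriction of $\Pi$ to $R\cup C$, and let $\mathcal{F}$ be a one-factorization of $K_{n,n}$ with $\Delta\le\Phi_{\mathcal{F}}$. Then $\mathcal{F}$ is compatible with $\Pi$ if and only if the action of $\Delta$ on $\mathcal{F}$ has, for each length, the same number of orbits of that length as the action of $\Pi$ on $S$.
   Context: $R,C,S$ are pairwise disjoint $n$-element sets; $\Gamma$ is the group of permutations of $R\cup C\cup S$ preserving $\{R,C,S\}$. $K_{n,n}$ is the complete bipartite graph on $R\cup C$ with bipartition $\{R,C\}$; $\Phi$ is the group of permutations of $R\cup C$ preserving $\{R,C\}$, acting on one-factorizations (sets of perfect matchings partitioning the edge set) via vertices, and $\Phi_{\mathcal{F}}$ is the stabilizer of $\mathcal{F}$. For $\delta\in\Delta$ let $\bar\delta$ be the permutation of $R\cup C\cup\mathcal{F}$ (disjoint union) induced by $\delta$ on $R\cup C$ and on $\mathcal{F}$; for a bijection $f:S\to\mathcal{F}$ let $\bar f$ extend $f$ by the identity on $R\cup C$. $(\mathcal{F},f)$ agrees with $\Pi$ if $\{\bar f^{ -1}\bar\delta\bar f:\delta\in\Delta\}=\Pi$, and $\mathcal{F}$ is compatible with $\Pi$ if there exists a bijection $f:S\to\mathcal{F}$ such that $(\mathcal{F},f)$ agrees with $\Pi$. -}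

module Defs where

open import Data.Nat using (ℕ; zero; suc)
open import Data.Fin using (Fin; _≟_)
import Data.Fin as Fin
open import Data.Bool using (Bool; true; false; _∧_; _∨_)
open import Data.Vec using (Vec; lookup; tabulate)
open import Data.Unit using (⊤)
open import Data.Empty using (⊥)
open import Data.Product using (Σ; ∃; _×_; _,_; proj₁; proj₂; Σ-syntax; ∃-syntax)
open import Data.Sum using (_⊎_; inj₁; inj₂; [_,_])
open import Relation.Binary.PropositionalEquality using (_≡_; refl)
open import Relation.Nullary using (¬_; Dec; yes; no)
open import Relation.Nullary.Decidable using (⌊_⌋)
open import Function using (_∘_)
open import Function.Bundles using (_↔_; Inverse; _⇔_; Equivalence)

-- The vertex sets.  R and C are the two sides of K_{n,n}; a vertex of
-- R ∪ C is a side together with an index in Fin n.  R ∪ C ∪ S is the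
-- disjoint union  V n ⊎ Fin n  (S = the inj₂ part).

data Side : Set where
  R C : Side

V : ℕ → Set
V n = Side × Fin n

U : ℕ → Set
U n = V n ⊎ Fin n

data Block : Set where
  bR bC bS : Block

InBlock : ∀ {n} → Block → U n → Set
InBlock bR (inj₁ (R , _)) = ⊤
InBlock bR (inj₁ (C , _)) = ⊥
InBlock bR (inj₂ _)       = ⊥
InBlock bC (inj₁ (R , _)) = ⊥
InBlock bC (inj₁ (C , _)) = ⊤
InBlock bC (inj₂ _)       = ⊥
InBlock bS (inj₁ _)       = ⊥
InBlock bS (inj₂ _)       = ⊤

InSide : ∀ {n} → Side → V n → Set
InSide X v = proj₁ v ≡ X

IsPerm : {X : Set} → (X → X) → Set
IsPerm {X} σ = Σ[ τ ∈ (X → X) ] ((∀ x → τ (σ x) ≡ x) × (∀ y → σ (τ y) ≡ y))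

ImageIs : {X : Set} → (X → X) → (X → Set) → (X → Set) → Set
ImageIs {X} σ P Q = (∀ x → P x → Q (σ x)) × (∀ y → Q y → Σ[ x ∈ X ] (P x × σ x ≡ y))

InΓ : ∀ {n} → (U n → U n) → Set
InΓ π = IsPerm π × (∀ X → Σ[ Y ∈ Block ] ImageIs π (InBlock X) (InBlock Y))

FixesS : ∀ {n} → (U n → U n) → Set
FixesS π = ImageIs π (InBlock bS) (InBlock bS)

-- Edge sets of K_{n,n}: the edge {(R,i),(C,j)} is present in m iff
-- entry (i , j) of m is true.

EdgeSet : ℕ → Set
EdgeSet n = Vec (Vec Bool n) n

Has : ∀ {n} → EdgeSet n → Fin n → Fin n → Set
Has m i j = lookup (lookup m i) j ≡ true

PerfectMatching : ∀ {n} → EdgeSet n → Set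
PerfectMatching {n} m =
  (∀ i → Σ[ j ∈ Fin n ] (Has m i j × (∀ j' → Has m i j' → j' ≡ j))) ×
  (∀ j → Σ[ i ∈ Fin n ] (Has m i j × (∀ i' → Has m i' j → i' ≡ i)))

-- a set of edge sets (a finite set, given by its characteristic function)
-- is a one-factorization: its members are perfect matchings and every
-- edge lies in exactly one member
OneFactorization : ∀ {n} → (EdgeSet n → Bool) → Set
OneFactorization {n} F =
  (∀ m → F m ≡ true → PerfectMatching m) ×
  (∀ i j → Σ[ m ∈ EdgeSet n ] ((F m ≡ true × Has m i j) ×
                               (∀ m' → F m' ≡ true → Has m' i j → m' ≡ m)))

-- Action of permutations of R ∪ C on edge sets: φ·m = { φ e : e ∈ m }

anyFin : ∀ {n} → (Fin n → Bool) → Bool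
anyFin {zero}  f = false
anyFin {suc n} f = f Fin.zero ∨ anyFin (f ∘ Fin.suc)

eqSide : Side → Side → Bool
eqSide R R = true
eqSide C C = true
eqSide R C = false
eqSide C R = false

eqV : ∀ {n} → V n → V n → Bool
eqV (s , i) (t , j) = eqSide s t ∧ ⌊ i ≟ j ⌋

sameEdge : ∀ {n} → V n → V n → Fin n → Fin n → Bool
sameEdge u v i' j' =
  (eqV u (R , i') ∧ eqV v (C , j')) ∨ (eqV u (C , j') ∧ eqV v (R , i'))

act : ∀ {n} → (V n → V n) → EdgeSet n → EdgeSet n
act φ m = tabulate λ i' → tabulate λ j' →
  anyFin λ i → anyFin λ j →
    lookup (lookup m i) j ∧ sameEdge (φ (R , i)) (φ (C , j)) i' j'

InΦ : ∀ {n} → (V n → V n) → Set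
InΦ φ = IsPerm φ × (∀ X → Σ[ Y ∈ Side ] ImageIs φ (InSide X) (InSide Y))

Stabilizes : ∀ {n} → (EdgeSet n → Bool) → (V n → V n) → Set
Stabilizes {n} F φ =
  ∀ m' → (F m' ≡ true) ⇔ (Σ[ m ∈ EdgeSet n ] (F m ≡ true × act φ m ≡ m'))

InΦF : ∀ {n} → (EdgeSet n → Bool) → (V n → V n) → Set
InΦF F φ = InΦ φ × Stabilizes F φ

stab-closed : ∀ {n} (F : EdgeSet n → Bool) (φ : V n → V n) → Stabilizes F φ →
              ∀ m → F m ≡ true → F (act φ m) ≡ true
stab-closed F φ st m p = Equivalence.from (st (act φ m)) (m , p , refl)

FElem : ∀ {n} → (EdgeSet n → Bool) → Set
FElem {n} F = Σ[ m ∈ EdgeSet n ] (F m ≡ true)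

-- Π = {id, π} and Δ = {id, δ} (δ the restriction of π to R ∪ C),
-- as sets of permutations (equality of permutations is pointwise)

InΠ : ∀ {n} → (U n → U n) → (U n → U n) → Set
InΠ π σ = (∀ x → σ x ≡ x) ⊎ (∀ x → σ x ≡ π x)

InΔ : ∀ {n} → (V n → V n) → (V n → V n) → Set
InΔ δ d = (∀ v → d v ≡ v) ⊎ (∀ v → d v ≡ δ v)

barAct : ∀ {n} (F : EdgeSet n → Bool) (d : V n → V n) →
         (∀ m → F m ≡ true → F (act d m) ≡ true) →
         V n ⊎ FElem F → V n ⊎ FElem F
barAct F d cl (inj₁ v)       = inj₁ (d v)
barAct F d cl (inj₂ (m , p)) = inj₂ (act d m , cl m p)

fbar : ∀ {n} (F : EdgeSet n → Bool) → (Fin n ↔ FElem F) → U n → V n ⊎ FElem F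
fbar F f = [ inj₁ , inj₂ ∘ Inverse.to f ]

fbarInv : ∀ {n} (F : EdgeSet n → Bool) → (Fin n ↔ FElem F) → V n ⊎ FElem F → U n
fbarInv F f = [ inj₁ , inj₂ ∘ Inverse.from f ]

-- (F , f) agrees with Π :  { f̄⁻¹ δ̄ f̄ : δ ∈ Δ } = Π
Agrees : ∀ {n} (F : EdgeSet n → Bool) (δ : V n → V n) (π : U n → U n) →
         (∀ d → InΔ δ d → InΦF F d) → (Fin n ↔ FElem F) → Set
Agrees {n} F δ π hΔ f =
  ∀ (σ : U n → U n) →
    InΠ π σ ⇔
    (Σ[ d ∈ (V n → V n) ] Σ[ h ∈ InΔ δ d ]
       (∀ x → σ x ≡ fbarInv F f
                      (barAct F d (stab-closed F d (proj₂ (hΔ d h))) (fbar F f x))))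

Compatible : ∀ {n} (F : EdgeSet n → Bool) (δ : V n → V n) (π : U n → U n) →
             (∀ d → InΔ δ d → InΦF F d) → Set
Compatible {n} F δ π hΔ = Σ[ f ∈ (Fin n ↔ FElem F) ] Agrees F δ π hΔ f

-- Counting orbits.  An action is given by its orbit relation
-- Orb x y  ("y lies in the orbit of x").

HasSize : {X : Set} → (X → Set) → ℕ → Set
HasSize {X} P k =
  Σ[ e ∈ (Fin k → X) ]
    ((∀ a b → e a ≡ e b → a ≡ b) × (∀ a → P (e a)) ×
     (∀ y → P y → Σ[ a ∈ Fin k ] e a ≡ y))

OrbitCount : (X : Set) → (X → X → Set) → ℕ → ℕ → Set
OrbitCount X Orb k N =
  Σ[ rep ∈ (Fin N → X) ]
    ((∀ a → HasSize (Orb (rep a)) k) ×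
     (∀ a b → Orb (rep a) (rep b) → a ≡ b) ×
     (∀ x → HasSize (Orb x) k → Σ[ a ∈ Fin N ] Orb (rep a) x))

OrbΔ : ∀ {n} (F : EdgeSet n → Bool) (δ : V n → V n) → FElem F → FElem F → Set
OrbΔ {n} F δ m m' = Σ[ d ∈ (V n → V n) ] (InΔ δ d × act d (proj₁ m) ≡ proj₁ m')

OrbΠ : ∀ {n} (π : U n → U n) → Fin n → Fin n → Set
OrbΠ {n} π s s' = Σ[ σ ∈ (U n → U n) ] (InΠ π σ × σ (inj₂ s) ≡ inj₂ s')

-- Lemma 4.5.  Let p be the involution that π induces on S and q the
-- involution that δ induces on F (δ is an involution because π is, and Δ
-- stabilizes F).  Both actions in the lemma are actions of a group of order
-- two, so their orbits are the orbits {x , p x} of an involution: fixed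
-- points (length 1) and swapped pairs (length 2).
--  * (F , f) agrees with Π exactly when f : S → F conjugates p into q,
--    f ∘ p = q ∘ f  (module Setting.Agreement).
--  * Conjugate maps have the same orbit counts, because orbit counts are
--    transported along relation-preserving bijections.
--  * Conversely an involution with N₁ fixed points and N₂ swapped pairs is
--    conjugate to the standard involution on Fin N₁ ⊎ (Fin N₂ × Bool); every
--    involution of Fin n has such counts.  So equal counts give f ∘ p = q ∘ f.
module Submission where

open import Defs
open import Data.Nat using (ℕ; zero; suc; _<_)
open import Data.Nat.Properties using (<-irrefl; <-asym; <-cmp; _<?_)
open import Data.Fin using (Fin; toℕ) renaming (zero to fzero; suc to fsuc)
open import Data.Fin.Properties using (suc-injective; toℕ-injective) renaming (_≟_ to _≟ᶠ_)
open import Data.Bool using (Bool; true; false; not; _∧_; _∨_)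
open import Data.Bool.Properties using (⇔→≡) renaming (_≟_ to _≟ᵇ_)
open import Data.Vec using (Vec; lookup; tabulate)
open import Data.Vec.Properties using (≡-dec; lookup∘tabulate; tabulate∘lookup; tabulate-cong)
open import Data.Empty using (⊥; ⊥-elim)
open import Data.Unit using (tt)
open import Data.Product using (Σ; _×_; _,_; proj₁; proj₂; Σ-syntax)
open import Data.Sum using (_⊎_; inj₁; inj₂)
open import Data.Sum.Properties using (inj₁-injective; inj₂-injective)
open import Relation.Binary.PropositionalEquality
open import Relation.Binary.Definitions using (DecidableEquality; tri<; tri≈; tri>)
open import Relation.Nullary using (¬_; Dec; yes; no)
open import Function using (_∘_; id)
open import Function.Bundles using (_↔_; Inverse; _⇔_; Equivalence; mk⇔; mk↔ₛ′)
open import Function.Construct.Identity using (↔-id)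
open import Function.Construct.Symmetry using (↔-sym; ⇔-sym)
open import Function.Construct.Composition using (_↔-∘_; _⇔-∘_)
open import Data.Product.Function.NonDependent.Propositional using (_×-⇔_)
open import Data.Sum.Function.Propositional using (_⊎-⇔_)
open import Axiom.UniquenessOfIdentityProofs using (module Decidable⇒UIP)

module Transport {X Y : Set} (f : X ↔ Y) where
  open Inverse f

  to-injective : ∀ {x x'} → to x ≡ to x' → x ≡ x'
  to-injective {x} {x'} eq = begin
    x              ≡⟨ sym (strictlyInverseʳ x) ⟩
    from (to x)    ≡⟨ cong from eq ⟩
    from (to x')   ≡⟨ strictlyInverseʳ x' ⟩
    x'             ∎
    where open ≡-Reasoning

  hasSize : (P : X → Set) (Q : Y → Set) →
            (∀ x → P x → Q (to x)) → (∀ y → Q y → P (from y)) →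
            ∀ {k} → HasSize P k → HasSize Q k
  hasSize P Q P⇒Q Q⇒P (e , e-inj , e-mem , e-onto) =
      to ∘ e
    , (λ a b eq → e-inj a b (to-injective eq))
    , (λ a → P⇒Q (e a) (e-mem a))
    , λ y Qy → let a , ea≡ = e-onto (from y) (Q⇒P y Qy)
               in a , trans (cong to ea≡) (strictlyInverseˡ y)

orbitCount-transport :
  {X Y : Set} (f : X ↔ Y) {Rx : X → X → Set} {Ry : Y → Y → Set} →
  (∀ {x x'} → Rx x x' → Ry (Inverse.to f x) (Inverse.to f x')) →
  (∀ {y y'} → Ry y y' → Rx (Inverse.from f y) (Inverse.from f y')) →
  ∀ {k N} → OrbitCount X Rx k N → OrbitCount Y Ry k N
orbitCount-transport f {Rx} {Ry} to-rel from-rel (rep , size , distinct , cover) =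
    to ∘ rep
  , (λ a → Transport.hasSize f (Rx (rep a)) (Ry (to (rep a))) (λ _ → to-rel)
             (λ _ r → subst (λ z → Rx z _) (strictlyInverseʳ (rep a)) (from-rel r))
             (size a))
  , (λ a b r → distinct a b (subst₂ Rx (strictlyInverseʳ (rep a)) (strictlyInverseʳ (rep b))
                                      (from-rel r)))
  , λ y size-y →
      let a , r = cover (from y)
                    (Transport.hasSize (↔-sym f) (Ry y) (Rx (from y)) (λ _ → from-rel)
                       (λ _ r → subst (λ z → Ry z _) (strictlyInverseˡ y) (to-rel r)) size-y)
      in a , subst (Ry (to (rep a))) (strictlyInverseˡ y) (to-rel r)
  where open Inverse f

orbitCount-cong : {X : Set} {R R' : X → X → Set} → (∀ x y → R x y ⇔ R' x y) →
                  ∀ k N → OrbitCount X R k N ⇔ OrbitCount X R' k N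
orbitCount-cong R⇔R' k N =
  mk⇔ (orbitCount-transport (↔-id _) (Equivalence.to (R⇔R' _ _)) (Equivalence.from (R⇔R' _ _)))
      (orbitCount-transport (↔-id _) (Equivalence.from (R⇔R' _ _)) (Equivalence.to (R⇔R' _ _)))

-- The orbit relation of the group {id , p}: y lies in the orbit {x , p x}.
Inv : {X : Set} → (X → X) → X → X → Set
Inv p x y = y ≡ x ⊎ y ≡ p x

Conjugates : {X Y : Set} → X ↔ Y → (X → X) → (Y → Y) → Set
Conjugates f p q = ∀ x → Inverse.to f (p x) ≡ q (Inverse.to f x)

conjugates-sym : {X Y : Set} (f : X ↔ Y) {p : X → X} {q : Y → Y} →
                 Conjugates f p q → Conjugates (↔-sym f) q p
conjugates-sym f {p} {q} fp≡qf y = begin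
  from (q y)                 ≡⟨ cong (from ∘ q) (sym (strictlyInverseˡ y)) ⟩
  from (q (to (from y)))     ≡⟨ cong from (sym (fp≡qf (from y))) ⟩
  from (to (p (from y)))     ≡⟨ strictlyInverseʳ (p (from y)) ⟩
  p (from y)                 ∎
  where open Inverse f
        open ≡-Reasoning

conjugates-∘ : {X Y Z : Set} (g : Y ↔ Z) (f : X ↔ Y) {p : X → X} {q : Y → Y} {r : Z → Z} →
               Conjugates g q r → Conjugates f p q → Conjugates (g ↔-∘ f) p r
conjugates-∘ g f gq≡rg fp≡qf x =
  trans (cong (Inverse.to g) (fp≡qf x)) (gq≡rg (Inverse.to f x))

Inv-transport : {X Y : Set} (f : X ↔ Y) (p : X → X) (q : Y → Y) → Conjugates f p q →
                ∀ {x x'} → Inv p x x' → Inv q (Inverse.to f x) (Inverse.to f x')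
Inv-transport f p q fp≡qf (inj₁ x'≡x)  = inj₁ (cong (Inverse.to f) x'≡x)
Inv-transport f p q fp≡qf (inj₂ x'≡px) = inj₂ (trans (cong (Inverse.to f) x'≡px) (fp≡qf _))

conjugate-orbitCounts : {X Y : Set} (f : X ↔ Y) {p : X → X} {q : Y → Y} →
  Conjugates f p q → ∀ k N → OrbitCount X (Inv p) k N ⇔ OrbitCount Y (Inv q) k N
conjugate-orbitCounts f {p} {q} fp≡qf k N =
  mk⇔ (orbitCount-transport f (Inv-transport f p q fp≡qf) (Inv-transport (↔-sym f) q p qf≡fp))
      (orbitCount-transport (↔-sym f) (Inv-transport (↔-sym f) q p qf≡fp) (Inv-transport f p q fp≡qf))
  where qf≡fp : Conjugates (↔-sym f) q p
        qf≡fp = conjugates-sym f fp≡qf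

module OrbitsOf {X : Set} (p : X → X) where

  Fixed : X → Set
  Fixed x = p x ≡ x

  size1⇒fixed : ∀ x → HasSize (Inv p x) 1 → Fixed x
  size1⇒fixed x (e , _ , _ , onto) with onto x (inj₁ refl) | onto (p x) (inj₂ refl)
  ... | fzero , e0≡x | fzero , e0≡px = trans (sym e0≡px) e0≡x

  size2⇒moving : ∀ x → HasSize (Inv p x) 2 → ¬ Fixed x
  size2⇒moving x (e , e-inj , e-mem , _) px≡x
    with e-inj fzero (fsuc fzero) (trans (e≡x fzero) (sym (e≡x (fsuc fzero))))
    where e≡x : ∀ a → e a ≡ x
          e≡x a with e-mem a
          ... | inj₁ ea≡x  = ea≡x
          ... | inj₂ ea≡px = trans ea≡px px≡x
  ... | ()

  fixed⇒size1 : ∀ x → Fixed x → HasSize (Inv p x) 1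
  fixed⇒size1 x px≡x =
      (λ _ → x)
    , (λ { fzero fzero _ → refl })
    , (λ _ → inj₁ refl)
    , λ { y (inj₁ y≡x) → fzero , sym y≡x ; y (inj₂ y≡px) → fzero , sym (trans y≡px px≡x) }

  moving⇒size2 : ∀ x → ¬ Fixed x → HasSize (Inv p x) 2
  moving⇒size2 x moving = e , e-inj , e-mem , e-onto
    where
    e : Fin 2 → X
    e fzero    = x
    e (fsuc _) = p x
    e-inj : ∀ a b → e a ≡ e b → a ≡ b
    e-inj fzero        fzero        _       = refl
    e-inj fzero        (fsuc fzero) x≡px    = ⊥-elim (moving (sym x≡px))
    e-inj (fsuc fzero) fzero        px≡x    = ⊥-elim (moving px≡x)
    e-inj (fsuc fzero) (fsuc fzero) _       = refl
    e-mem : ∀ a → Inv p x (e a)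
    e-mem fzero    = inj₁ refl
    e-mem (fsuc _) = inj₂ refl
    e-onto : ∀ y → Inv p x y → Σ[ a ∈ Fin 2 ] e a ≡ y
    e-onto y (inj₁ y≡x)  = fzero , sym y≡x
    e-onto y (inj₂ y≡px) = fsuc fzero , sym y≡px

  fixedPoints⇒orbitCount₁ : ∀ {N} → HasSize Fixed N → OrbitCount X (Inv p) 1 N
  fixedPoints⇒orbitCount₁ (e , e-inj , e-fixed , e-onto) =
      e
    , (λ a → fixed⇒size1 (e a) (e-fixed a))
    , (λ { a b (inj₁ eb≡ea)  → e-inj a b (sym eb≡ea)
         ; a b (inj₂ eb≡pea) → e-inj a b (sym (trans eb≡pea (e-fixed a))) })
    , λ x size1 → let a , ea≡x = e-onto x (size1⇒fixed x size1) in a , inj₁ (sym ea≡x)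

Std : ℕ → ℕ → Set
Std N₁ N₂ = Fin N₁ ⊎ (Fin N₂ × Bool)

swap : ∀ {N₁ N₂} → Std N₁ N₂ → Std N₁ N₂
swap (inj₁ a)       = inj₁ a
swap (inj₂ (a , b)) = inj₂ (a , not b)

module Involution {X : Set} (p : X → X) (p-invol : ∀ x → p (p x) ≡ x) where
  open OrbitsOf p public

  Inv-sym : ∀ {x y} → Inv p x y → Inv p y x
  Inv-sym (inj₁ y≡x)  = inj₁ (sym y≡x)
  Inv-sym (inj₂ y≡px) = inj₂ (trans (sym (p-invol _)) (cong p (sym y≡px)))

  Inv-trans : ∀ {x y z} → Inv p x y → Inv p y z → Inv p x z
  Inv-trans (inj₁ y≡x)  (inj₁ z≡y)  = inj₁ (trans z≡y y≡x)
  Inv-trans (inj₁ y≡x)  (inj₂ z≡py) = inj₂ (trans z≡py (cong p y≡x))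
  Inv-trans (inj₂ y≡px) (inj₁ z≡y)  = inj₂ (trans z≡y y≡px)
  Inv-trans (inj₂ y≡px) (inj₂ z≡py) = inj₁ (trans z≡py (trans (cong p y≡px) (p-invol _)))

  transversal⇒orbitCount₂ : (T : X → Set) →
    (∀ x → T x → ¬ Fixed x) → (∀ x → T x → ¬ T (p x)) →
    (∀ x → ¬ Fixed x → T x ⊎ T (p x)) →
    ∀ {N} → HasSize T N → OrbitCount X (Inv p) 2 N
  transversal⇒orbitCount₂ T T-moving T-once T-meets (e , e-inj , e-T , e-onto) =
      e
    , (λ a → moving⇒size2 (e a) (T-moving (e a) (e-T a)))
    , (λ { a b (inj₁ eb≡ea)  → e-inj a b (sym eb≡ea)
         ; a b (inj₂ eb≡pea) → ⊥-elim (T-once (e a) (e-T a) (subst T eb≡pea (e-T b))) })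
    , λ x size2 → meet x (T-meets x (size2⇒moving x size2))
    where
    meet : ∀ x → T x ⊎ T (p x) → Σ[ a ∈ _ ] Inv p (e a) x
    meet x (inj₁ Tx)  = let a , ea≡x  = e-onto x Tx      in a , inj₁ (sym ea≡x)
    meet x (inj₂ Tpx) = let a , ea≡px = e-onto (p x) Tpx
                        in a , inj₂ (trans (sym (p-invol x)) (cong p (sym ea≡px)))

  -- An involution with N₁ orbits of length 1 and N₂ orbits of length 2 on a
  -- set with decidable equality is conjugate to the standard one: label the
  -- fixed points by Fin N₁ and the points of the a-th 2-orbit by (a , false)
  -- for its representative r and (a , true) for p r.
  module Labelling (_≟_ : DecidableEquality X) {N₁ N₂ : ℕ}
                   (orbits₁ : OrbitCount X (Inv p) 1 N₁)
                   (orbits₂ : OrbitCount X (Inv p) 2 N₂) where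
    open Σ orbits₁ renaming (proj₁ to rep₁; proj₂ to props₁)
    open Σ orbits₂ renaming (proj₁ to rep₂; proj₂ to props₂)

    label : Std N₁ N₂ → X
    label (inj₁ a)           = rep₁ a
    label (inj₂ (a , false)) = rep₂ a
    label (inj₂ (a , true))  = p (rep₂ a)

    label-swap : ∀ l → label (swap l) ≡ p (label l)
    label-swap (inj₁ a)           = sym (size1⇒fixed _ (proj₁ props₁ a))
    label-swap (inj₂ (a , false)) = refl
    label-swap (inj₂ (a , true))  = sym (p-invol _)

    label-fixed : ∀ a → Fixed (label (inj₁ a))
    label-fixed a = sym (label-swap (inj₁ a))

    label-moving : ∀ c → ¬ Fixed (label (inj₂ c))
    label-moving (a , false) = size2⇒moving _ (proj₁ props₂ a)
    label-moving (a , true)  = λ fixed →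
      size2⇒moving _ (proj₁ props₂ a) (trans (sym fixed) (p-invol _))

    label-inOrbit : ∀ a b → Inv p (rep₂ a) (label (inj₂ (a , b)))
    label-inOrbit a false = inj₁ refl
    label-inOrbit a true  = inj₂ refl

    label-injective : ∀ l l' → label l ≡ label l' → l ≡ l'
    label-injective (inj₁ a) (inj₁ b) eq = cong inj₁ (proj₁ (proj₂ props₁) a b (inj₁ (sym eq)))
    label-injective (inj₁ a) (inj₂ c) eq = ⊥-elim (label-moving c (subst Fixed eq (label-fixed a)))
    label-injective (inj₂ c) (inj₁ b) eq =
      ⊥-elim (label-moving c (subst Fixed (sym eq) (label-fixed b)))
    label-injective (inj₂ (a , b)) (inj₂ (a' , b')) eq
      with proj₁ (proj₂ props₂) a a'
             (Inv-trans (label-inOrbit a b)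
                        (subst (λ z → Inv p z (rep₂ a')) (sym eq) (Inv-sym (label-inOrbit a' b'))))
    ... | refl = cong (λ b → inj₂ (a , b)) (same-side b b' eq)
      where
      same-side : ∀ b b' → label (inj₂ (a , b)) ≡ label (inj₂ (a , b')) → b ≡ b'
      same-side false false _  = refl
      same-side true  true  _  = refl
      same-side false true  eq = ⊥-elim (label-moving (a , false) (sym eq))
      same-side true  false eq = ⊥-elim (label-moving (a , false) eq)

    unlabel : ∀ x → Σ[ l ∈ Std N₁ N₂ ] label l ≡ x
    unlabel x with p x ≟ x
    ... | yes fixed with proj₂ (proj₂ props₁) x (fixed⇒size1 x fixed)
    ...   | a , inj₁ x≡r  = inj₁ a , sym x≡r
    ...   | a , inj₂ x≡pr = inj₁ a , sym (trans x≡pr (label-fixed a))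
    unlabel x | no moving with proj₂ (proj₂ props₂) x (moving⇒size2 x moving)
    ...   | a , inj₁ x≡r  = inj₂ (a , false) , sym x≡r
    ...   | a , inj₂ x≡pr = inj₂ (a , true) , sym x≡pr

    labelling : Σ[ g ∈ Std N₁ N₂ ↔ X ] Conjugates g swap p
    labelling =
        mk↔ₛ′ label (proj₁ ∘ unlabel) (proj₂ ∘ unlabel)
              (λ l → label-injective _ _ (proj₂ (unlabel (label l))))
      , label-swap

hasSize-cons : ∀ {n N} {P : Fin (suc n) → Set} →
               P fzero → HasSize (P ∘ fsuc) N → HasSize P (suc N)
hasSize-cons {P = P} P0 (e , e-inj , e-mem , e-onto) = e' , e'-inj , e'-mem , e'-onto
  where
  e' : Fin (suc _) → Fin (suc _)
  e' fzero    = fzero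
  e' (fsuc a) = fsuc (e a)
  e'-inj : ∀ a b → e' a ≡ e' b → a ≡ b
  e'-inj fzero    fzero    _  = refl
  e'-inj fzero    (fsuc b) ()
  e'-inj (fsuc a) fzero    ()
  e'-inj (fsuc a) (fsuc b) eq = cong fsuc (e-inj a b (suc-injective eq))
  e'-mem : ∀ a → P (e' a)
  e'-mem fzero    = P0
  e'-mem (fsuc a) = e-mem a
  e'-onto : ∀ x → P x → Σ[ a ∈ _ ] e' a ≡ x
  e'-onto fzero    _  = fzero , refl
  e'-onto (fsuc x) Px = let a , ea≡x = e-onto x Px in fsuc a , cong fsuc ea≡x

hasSize-skip : ∀ {n N} {P : Fin (suc n) → Set} →
               ¬ P fzero → HasSize (P ∘ fsuc) N → HasSize P N
hasSize-skip ¬P0 (e , e-inj , e-mem , e-onto) =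
    fsuc ∘ e
  , (λ a b eq → e-inj a b (suc-injective eq))
  , e-mem
  , λ { fzero P0 → ⊥-elim (¬P0 P0)
      ; (fsuc x) Px → let a , ea≡x = e-onto x Px in a , cong fsuc ea≡x }

enumerate : ∀ {n} (P : Fin n → Set) → (∀ x → Dec (P x)) → Σ[ N ∈ ℕ ] HasSize P N
enumerate {zero}  P P? = 0 , (λ ()) , (λ ()) , (λ ()) , λ ()
enumerate {suc n} P P? with enumerate (P ∘ fsuc) (P? ∘ fsuc) | P? fzero
... | N , size | yes P0 = suc N , hasSize-cons P0 size
... | N , size | no ¬P0 = N , hasSize-skip ¬P0 size

-- Every involution of Fin n has some numbers N₁, N₂ of orbits of length 1
-- and 2; the points x < p x form a transversal of the 2-orbits.
finInvolution-orbitCounts : ∀ {n} (p : Fin n → Fin n) → (∀ x → p (p x) ≡ x) →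
  Σ[ N₁ ∈ ℕ ] Σ[ N₂ ∈ ℕ ]
    (OrbitCount (Fin n) (Inv p) 1 N₁ × OrbitCount (Fin n) (Inv p) 2 N₂)
finInvolution-orbitCounts p p-invol =
  let N₁ , fixedPoints = enumerate Fixed (λ x → p x ≟ᶠ x)
      N₂ , lowerPoints = enumerate Lower (λ x → toℕ x <? toℕ (p x))
  in  N₁ , N₂ , fixedPoints⇒orbitCount₁ fixedPoints
              , transversal⇒orbitCount₂ Lower lower-moving lower-once lower-meets lowerPoints
  where
  open Involution p p-invol
  Lower : Fin _ → Set
  Lower x = toℕ x < toℕ (p x)
  lower-moving : ∀ x → Lower x → ¬ Fixed x
  lower-moving x x<px px≡x = <-irrefl (cong toℕ (sym px≡x)) x<px
  lower-once : ∀ x → Lower x → ¬ Lower (p x)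
  lower-once x x<px px<ppx = <-asym x<px (subst (λ z → toℕ (p x) < toℕ z) (p-invol x) px<ppx)
  lower-meets : ∀ x → ¬ Fixed x → Lower x ⊎ Lower (p x)
  lower-meets x moving with <-cmp (toℕ x) (toℕ (p x))
  ... | tri< x<px _ _ = inj₁ x<px
  ... | tri≈ _ x≡px _ = ⊥-elim (moving (sym (toℕ-injective x≡px)))
  ... | tri> _ _ px<x = inj₂ (subst (λ z → toℕ (p x) < toℕ z) (sym (p-invol x)) px<x)

∧-true : ∀ {a b} → (a ∧ b) ≡ true ⇔ (a ≡ true × b ≡ true)
∧-true {true}  = mk⇔ (refl ,_) proj₂
∧-true {false} = mk⇔ (λ ()) (λ { (() , _) })

∨-true : ∀ {a b} → (a ∨ b) ≡ true ⇔ (a ≡ true ⊎ b ≡ true)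
∨-true {true}  = mk⇔ (λ _ → inj₁ refl) (λ _ → refl)
∨-true {false} = mk⇔ inj₂ (λ { (inj₁ ()) ; (inj₂ b≡true) → b≡true })

anyFin-true : ∀ {n} (f : Fin n → Bool) → anyFin f ≡ true ⇔ (Σ[ i ∈ Fin n ] f i ≡ true)
anyFin-true {zero}  f = mk⇔ (λ ()) (λ ())
anyFin-true {suc n} f = mk⇔ to from
  where
  rest = anyFin-true (f ∘ fsuc)
  to : anyFin f ≡ true → Σ[ i ∈ Fin (suc n) ] f i ≡ true
  to h with Equivalence.to (∨-true {f fzero}) h
  ... | inj₁ f0 = fzero , f0
  ... | inj₂ fs = let i , fi = Equivalence.to rest fs in fsuc i , fi
  from : Σ[ i ∈ Fin (suc n) ] f i ≡ true → anyFin f ≡ true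
  from (fzero  , f0) = Equivalence.from ∨-true (inj₁ f0)
  from (fsuc i , fi) = Equivalence.from (∨-true {f fzero}) (inj₂ (Equivalence.from rest (i , fi)))

eqV-true : ∀ {n} (u w : V n) → eqV u w ≡ true ⇔ u ≡ w
eqV-true (s , i) (t , j) with i ≟ᶠ j
eqV-true (R , i) (R , .i) | yes refl = mk⇔ (λ _ → refl) (λ _ → refl)
eqV-true (C , i) (C , .i) | yes refl = mk⇔ (λ _ → refl) (λ _ → refl)
eqV-true (R , i) (R , j)  | no i≢j   = mk⇔ (λ ()) (λ eq → ⊥-elim (i≢j (cong proj₂ eq)))
eqV-true (C , i) (C , j)  | no i≢j   = mk⇔ (λ ()) (λ eq → ⊥-elim (i≢j (cong proj₂ eq)))
eqV-true (R , i) (C , j)  | _        = mk⇔ (λ ()) (λ ())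
eqV-true (C , i) (R , j)  | _        = mk⇔ (λ ()) (λ ())

IsEdge : ∀ {n} → V n → V n → Fin n → Fin n → Set
IsEdge u v i j = (u ≡ (R , i) × v ≡ (C , j)) ⊎ (u ≡ (C , j) × v ≡ (R , i))

sameEdge-true : ∀ {n} (u v : V n) i j → sameEdge u v i j ≡ true ⇔ IsEdge u v i j
sameEdge-true u v i j =
  ((eqV-true u (R , i) ×-⇔ eqV-true v (C , j)) ⊎-⇔ (eqV-true u (C , j) ×-⇔ eqV-true v (R , i)))
    ⇔-∘ ((∧-true ⊎-⇔ ∧-true) ⇔-∘ ∨-true)

IsEdge-swap : ∀ {n} {u v : V n} {i j} → IsEdge u v i j → IsEdge v u i j
IsEdge-swap (inj₁ (u≡ , v≡)) = inj₂ (v≡ , u≡)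
IsEdge-swap (inj₂ (u≡ , v≡)) = inj₁ (v≡ , u≡)

IsEdge-image : ∀ {n} (e : V n → V n) {u v : V n} {i j i' j'} → IsEdge u v i j →
               IsEdge (e u) (e v) i' j' ⇔ IsEdge (e (R , i)) (e (C , j)) i' j'
IsEdge-image e (inj₁ (refl , refl)) = mk⇔ id id
IsEdge-image e (inj₂ (refl , refl)) = mk⇔ IsEdge-swap IsEdge-swap

Image : ∀ {n} → (V n → V n) → EdgeSet n → Fin n → Fin n → Set
Image {n} φ m i' j' =
  Σ[ i ∈ Fin n ] Σ[ j ∈ Fin n ] (Has m i j × IsEdge (φ (R , i)) (φ (C , j)) i' j')

Has-act : ∀ {n} (φ : V n → V n) m i' j' → Has (act φ m) i' j' ⇔ Image φ m i' j'
Has-act φ m i' j' = mk⇔ to from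
  where
  entry : lookup (lookup (act φ m) i') j' ≡
          anyFin λ i → anyFin λ j → lookup (lookup m i) j ∧ sameEdge (φ (R , i)) (φ (C , j)) i' j'
  entry = trans (cong (λ row → lookup row j') (lookup∘tabulate _ i')) (lookup∘tabulate _ j')
  to : Has (act φ m) i' j' → Image φ m i' j'
  to h = let i , hᵢ  = Equivalence.to (anyFin-true _) (trans (sym entry) h)
             j , hᵢⱼ = Equivalence.to (anyFin-true _) hᵢ
             has , edge = Equivalence.to ∧-true hᵢⱼ
         in i , j , has , Equivalence.to (sameEdge-true _ _ i' j') edge
  from : Image φ m i' j' → Has (act φ m) i' j'
  from (i , j , has , edge) =
    trans entry (Equivalence.from (anyFin-true _) (i , Equivalence.from (anyFin-true _)
      (j , Equivalence.from ∧-true (has , Equivalence.from (sameEdge-true _ _ i' j') edge))))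

vec-ext : ∀ {A : Set} {n} {xs ys : Vec A n} → (∀ i → lookup xs i ≡ lookup ys i) → xs ≡ ys
vec-ext {xs = xs} {ys} eq =
  trans (sym (tabulate∘lookup xs)) (trans (tabulate-cong eq) (tabulate∘lookup ys))

edge-ext : ∀ {n} {m m' : EdgeSet n} → (∀ i j → Has m i j ⇔ Has m' i j) → m ≡ m'
edge-ext same = vec-ext (λ i → vec-ext (λ j → ⇔→≡ (same i j)))

act-cong : ∀ {n} {d d' : V n → V n} → (∀ v → d v ≡ d' v) → ∀ m → act d m ≡ act d' m
act-cong {d = d} {d'} d≗d' m = edge-ext λ i' j' →
  ⇔-sym (Has-act d' m i' j') ⇔-∘ (mk⇔ (image d≗d') (image (sym ∘ d≗d')) ⇔-∘ Has-act d m i' j')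
  where
  image : ∀ {e e'} → (∀ v → e v ≡ e' v) → ∀ {i' j'} → Image e m i' j' → Image e' m i' j'
  image e≗e' {i'} {j'} (i , j , has , edge) =
    i , j , has , subst₂ (λ u v → IsEdge u v i' j') (e≗e' _) (e≗e' _) edge

act-identity : ∀ {n} (m : EdgeSet n) → act id m ≡ m
act-identity m = edge-ext λ i' j' → mk⇔ (image-id ∘ Equivalence.to (Has-act id m i' j'))
  (λ has → Equivalence.from (Has-act id m i' j') (i' , j' , has , inj₁ (refl , refl)))
  where
  image-id : ∀ {i' j'} → Image id m i' j' → Has m i' j'
  image-id (i , j , has , inj₁ (refl , refl)) = has
  image-id (i , j , has , inj₂ (() , _))

EdgePreserving : ∀ {n} → (V n → V n) → Set
EdgePreserving {n} d = ∀ i j → Σ[ i' ∈ Fin n ] Σ[ j' ∈ Fin n ] IsEdge (d (R , i)) (d (C , j)) i' j'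

act-∘ : ∀ {n} (e d : V n → V n) → EdgePreserving d → ∀ m → act e (act d m) ≡ act (e ∘ d) m
act-∘ e d d-edges m = edge-ext λ i' j' →
  ⇔-sym (Has-act (e ∘ d) m i' j') ⇔-∘ (mk⇔ to from ⇔-∘ Has-act e (act d m) i' j')
  where
  to : ∀ {i' j'} → Image e (act d m) i' j' → Image (e ∘ d) m i' j'
  to (i , j , has-d , edge-e) =
    let a , b , has , edge-d = Equivalence.to (Has-act d m i j) has-d
    in a , b , has , Equivalence.from (IsEdge-image e edge-d) edge-e
  from : ∀ {i' j'} → Image (e ∘ d) m i' j' → Image e (act d m) i' j'
  from (a , b , has , edge-ed) =
    let i , j , edge-d = d-edges a b
    in i , j , Equivalence.from (Has-act d m i j) (a , b , has , edge-d)
             , Equivalence.to (IsEdge-image e edge-d) edge-ed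

opposite⇒edge : ∀ {n} (u v : V n) → proj₁ u ≢ proj₁ v →
                Σ[ i ∈ Fin n ] Σ[ j ∈ Fin n ] IsEdge u v i j
opposite⇒edge (R , i) (C , j) _  = i , j , inj₁ (refl , refl)
opposite⇒edge (C , j) (R , i) _  = i , j , inj₂ (refl , refl)
opposite⇒edge (R , _) (R , _) ne = ⊥-elim (ne refl)
opposite⇒edge (C , _) (C , _) ne = ⊥-elim (ne refl)

-- Elements of Φ preserve edges: being injective and mapping the side R
-- onto a side, they keep R-vertices and C-vertices apart.
Φ-edgePreserving : ∀ {n} {d : V n → V n} → InΦ d → EdgePreserving d
Φ-edgePreserving {d = d} ((d⁻¹ , d⁻¹∘d , _) , sides) i j = opposite⇒edge _ _ separated
  where
  separated : proj₁ (d (R , i)) ≢ proj₁ (d (C , j))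
  separated same with sides R
  ... | Y , into , onto with onto (d (C , j)) (trans (sym same) (into (R , i) refl))
  ... | x , x∈R , dx≡dCj = R≢C (trans (sym x∈R) (cong proj₁ x≡Cj))
    where
    x≡Cj : x ≡ (C , j)
    x≡Cj = trans (sym (d⁻¹∘d x)) (trans (cong d⁻¹ dx≡dCj) (d⁻¹∘d (C , j)))
    R≢C : R ≢ C
    R≢C ()

act-involution : ∀ {n} {d : V n → V n} → InΦ d → (∀ v → d (d v) ≡ v) →
                 ∀ m → act d (act d m) ≡ m
act-involution {d = d} d∈Φ d-invol m = begin
  act d (act d m)  ≡⟨ act-∘ d d (Φ-edgePreserving d∈Φ) m ⟩
  act (d ∘ d) m    ≡⟨ act-cong d-invol m ⟩
  act id m         ≡⟨ act-identity m ⟩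
  m                ∎
  where open ≡-Reasoning

fromS : ∀ {n} (u : U n) → InBlock bS u → Σ[ s ∈ Fin n ] u ≡ inj₂ s
fromS (inj₂ s) _ = s , refl

-- An element of F is determined by its edge set (proofs of F m ≡ true are
-- unique), so the elements of F have decidable equality.
FElem-≡ : ∀ {n} {F : EdgeSet n → Bool} {y y' : FElem F} → proj₁ y ≡ proj₁ y' → y ≡ y'
FElem-≡ {y = m , m∈F} {.m , m∈F'} refl = cong (m ,_) (Decidable⇒UIP.≡-irrelevant _≟ᵇ_ m∈F m∈F')

FElem-≟ : ∀ {n} (F : EdgeSet n → Bool) → DecidableEquality (FElem F)
FElem-≟ F (m , _) (m' , _) with ≡-dec (≡-dec _≟ᵇ_) m m'
... | yes m≡m' = yes (FElem-≡ m≡m')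
... | no  m≢m' = no (m≢m' ∘ cong proj₁)

module Setting (n : ℕ) (π : U n → U n) (π-invol : ∀ x → π (π x) ≡ x)
  (π≢id : ¬ (∀ x → π x ≡ x)) (π-fixesS : FixesS π)
  (δ : V n → V n) (π-on-RC : ∀ v → π (inj₁ v) ≡ inj₁ (δ v))
  (F : EdgeSet n → Bool) (hΔ : ∀ d → InΔ δ d → InΦF F d) where

  δ-invol : ∀ v → δ (δ v) ≡ v
  δ-invol v = inj₁-injective (begin
    inj₁ (δ (δ v))    ≡⟨ sym (π-on-RC (δ v)) ⟩
    π (inj₁ (δ v))    ≡⟨ cong π (sym (π-on-RC v)) ⟩
    π (π (inj₁ v))    ≡⟨ π-invol (inj₁ v) ⟩
    inj₁ v            ∎)
    where open ≡-Reasoning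

  p : Fin n → Fin n
  p s = proj₁ (fromS (π (inj₂ s)) (proj₁ π-fixesS (inj₂ s) tt))

  π-on-S : ∀ s → π (inj₂ s) ≡ inj₂ (p s)
  π-on-S s = proj₂ (fromS (π (inj₂ s)) (proj₁ π-fixesS (inj₂ s) tt))

  p-invol : ∀ s → p (p s) ≡ s
  p-invol s = inj₂-injective (begin
    inj₂ (p (p s))    ≡⟨ sym (π-on-S (p s)) ⟩
    π (inj₂ (p s))    ≡⟨ cong π (sym (π-on-S s)) ⟩
    π (π (inj₂ s))    ≡⟨ π-invol (inj₂ s) ⟩
    inj₂ s            ∎)
    where open ≡-Reasoning

  δ∈ΦF : InΦF F δ
  δ∈ΦF = hΔ δ (inj₂ (λ _ → refl))

  q : FElem F → FElem F
  q (m , m∈F) = act δ m , stab-closed F δ (proj₂ δ∈ΦF) m m∈F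

  q-invol : ∀ y → q (q y) ≡ y
  q-invol (m , _) = FElem-≡ (act-involution (proj₁ δ∈ΦF) δ-invol m)

  OrbΠ⇔Inv : ∀ s s' → OrbΠ π s s' ⇔ Inv p s s'
  OrbΠ⇔Inv s s' = mk⇔ to from
    where
    to : OrbΠ π s s' → Inv p s s'
    to (σ , inj₁ σ≗id , σs≡s') = inj₁ (inj₂-injective (trans (sym σs≡s') (σ≗id _)))
    to (σ , inj₂ σ≗π  , σs≡s') =
      inj₂ (inj₂-injective (trans (sym σs≡s') (trans (σ≗π _) (π-on-S s))))
    from : Inv p s s' → OrbΠ π s s'
    from (inj₁ s'≡s)  = id , inj₁ (λ _ → refl) , cong inj₂ (sym s'≡s)
    from (inj₂ s'≡ps) = π , inj₂ (λ _ → refl) , trans (π-on-S s) (cong inj₂ (sym s'≡ps))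

  OrbΔ⇔Inv : ∀ y y' → OrbΔ F δ y y' ⇔ Inv q y y'
  OrbΔ⇔Inv y y' = mk⇔ to from
    where
    to : OrbΔ F δ y y' → Inv q y y'
    to (d , inj₁ d≗id , dy≡y') =
      inj₁ (FElem-≡ {F = F} (trans (sym dy≡y') (trans (act-cong d≗id (proj₁ y)) (act-identity (proj₁ y)))))
    to (d , inj₂ d≗δ  , dy≡y') = inj₂ (FElem-≡ {F = F} (trans (sym dy≡y') (act-cong d≗δ (proj₁ y))))
    from : Inv q y y' → OrbΔ F δ y y'
    from (inj₁ y'≡y)  = id , inj₁ (λ _ → refl) , trans (act-identity _) (cong proj₁ (sym y'≡y))
    from (inj₂ y'≡qy) = δ , inj₂ (λ _ → refl) , cong proj₁ (sym y'≡qy)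

  orbitCountsΠ : ∀ k N → OrbitCount (Fin n) (OrbΠ π) k N ⇔ OrbitCount (Fin n) (Inv p) k N
  orbitCountsΠ = orbitCount-cong OrbΠ⇔Inv

  orbitCountsΔ : ∀ k N → OrbitCount (FElem F) (OrbΔ F δ) k N ⇔ OrbitCount (FElem F) (Inv q) k N
  orbitCountsΔ = orbitCount-cong OrbΔ⇔Inv

  SameOrbitCounts : Set
  SameOrbitCounts =
    ∀ k N → OrbitCount (FElem F) (OrbΔ F δ) k N ⇔ OrbitCount (Fin n) (OrbΠ π) k N

  conjugacy⇒sameOrbitCounts : (f : Fin n ↔ FElem F) → Conjugates f p q → SameOrbitCounts
  conjugacy⇒sameOrbitCounts f fp≡qf k N =
    ⇔-sym (orbitCountsΠ k N) ⇔-∘ (⇔-sym (conjugate-orbitCounts f fp≡qf k N) ⇔-∘ orbitCountsΔ k N)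

  sameOrbitCounts⇒conjugacy : SameOrbitCounts → Σ[ f ∈ Fin n ↔ FElem F ] Conjugates f p q
  sameOrbitCounts⇒conjugacy same =
    let N₁ , N₂ , orbitsS₁ , orbitsS₂ = finInvolution-orbitCounts p p-invol
        gS , gS-conj = Involution.Labelling.labelling p p-invol _≟ᶠ_ orbitsS₁ orbitsS₂
        gF , gF-conj = Involution.Labelling.labelling q q-invol (FElem-≟ F)
                         (toF 1 N₁ orbitsS₁) (toF 2 N₂ orbitsS₂)
    in gF ↔-∘ ↔-sym gS , conjugates-∘ gF (↔-sym gS) {p} {swap} {q} gF-conj (conjugates-sym gS {swap} {p} gS-conj)
    where
    toF : ∀ k N → OrbitCount (Fin n) (Inv p) k N → OrbitCount (FElem F) (Inv q) k N
    toF k N = Equivalence.to (orbitCountsΔ k N) ∘ Equivalence.from (same k N)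
            ∘ Equivalence.from (orbitCountsΠ k N)

  module Agreement (f : Fin n ↔ FElem F) where
    open Inverse f

    conjugate : (d : V n → V n) → InΔ δ d → U n → U n
    conjugate d d∈Δ =
      fbarInv F f ∘ barAct F d (stab-closed F d (proj₂ (hΔ d d∈Δ))) ∘ fbar F f

    conjugate-id : ∀ d d∈Δ → (∀ v → d v ≡ v) → ∀ x → conjugate d d∈Δ x ≡ x
    conjugate-id d d∈Δ d≗id (inj₁ v) = cong inj₁ (d≗id v)
    conjugate-id d d∈Δ d≗id (inj₂ s) = cong inj₂ (begin
      from (act d (proj₁ (to s)) , _)  ≡⟨ cong from (FElem-≡ (trans (act-cong d≗id (proj₁ (to s))) (act-identity _))) ⟩
      from (to s)                      ≡⟨ strictlyInverseʳ s ⟩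
      s                                ∎)
      where open ≡-Reasoning

    conjugate-δ : Conjugates f p q → ∀ d d∈Δ → (∀ v → d v ≡ δ v) → ∀ x → conjugate d d∈Δ x ≡ π x
    conjugate-δ fp≡qf d d∈Δ d≗δ (inj₁ v) = trans (cong inj₁ (d≗δ v)) (sym (π-on-RC v))
    conjugate-δ fp≡qf d d∈Δ d≗δ (inj₂ s) = trans (cong inj₂ (begin
      from (act d (proj₁ (to s)) , _)  ≡⟨ cong from (FElem-≡ (act-cong d≗δ (proj₁ (to s)))) ⟩
      from (q (to s))                  ≡⟨ cong from (sym (fp≡qf s)) ⟩
      from (to (p s))                  ≡⟨ strictlyInverseʳ (p s) ⟩
      p s                              ∎)) (sym (π-on-S s))
      where open ≡-Reasoning

    conjugates⇒agrees : Conjugates f p q → Agrees F δ π hΔ f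
    conjugates⇒agrees fp≡qf σ = mk⇔ to-Δ from-Δ
      where
      to-Δ : InΠ π σ → Σ[ d ∈ (V n → V n) ] Σ[ d∈Δ ∈ InΔ δ d ] (∀ x → σ x ≡ conjugate d d∈Δ x)
      to-Δ (inj₁ σ≗id) = id , inj₁ (λ _ → refl) ,
        λ x → trans (σ≗id x) (sym (conjugate-id id (inj₁ (λ _ → refl)) (λ _ → refl) x))
      to-Δ (inj₂ σ≗π) = δ , inj₂ (λ _ → refl) ,
        λ x → trans (σ≗π x) (sym (conjugate-δ fp≡qf δ (inj₂ (λ _ → refl)) (λ _ → refl) x))
      from-Δ : Σ[ d ∈ (V n → V n) ] Σ[ d∈Δ ∈ InΔ δ d ] (∀ x → σ x ≡ conjugate d d∈Δ x) → InΠ π σ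
      from-Δ (d , inj₁ d≗id , σ≡) = inj₁ (λ x → trans (σ≡ x) (conjugate-id d (inj₁ d≗id) d≗id x))
      from-Δ (d , inj₂ d≗δ  , σ≡) =
        inj₂ (λ x → trans (σ≡ x) (conjugate-δ fp≡qf d (inj₂ d≗δ) d≗δ x))

    -- π ≠ id, so π must come from δ, which then forces f ∘ p = q ∘ f.
    agrees⇒conjugates : Agrees F δ π hΔ f → Conjugates f p q
    agrees⇒conjugates agrees s with Equivalence.to (agrees π) (inj₂ (λ _ → refl))
    ... | d , inj₁ d≗id , π≡ = ⊥-elim (π≢id (λ x → trans (π≡ x) (conjugate-id d (inj₁ d≗id) d≗id x)))
    ... | d , inj₂ d≗δ  , π≡ = begin
      to (p s)                          ≡⟨ cong to ps≡ ⟩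
      to (from (act d (proj₁ (to s)) , _)) ≡⟨ strictlyInverseˡ _ ⟩
      (act d (proj₁ (to s)) , _)        ≡⟨ FElem-≡ (act-cong d≗δ (proj₁ (to s))) ⟩
      q (to s)                          ∎
      where
      open ≡-Reasoning
      ps≡ : p s ≡ from (act d (proj₁ (to s)) , _)
      ps≡ = inj₂-injective (trans (sym (π-on-S s)) (π≡ (inj₂ s)))

-- Lemma 4.5.
lemma4p5 : (n : ℕ) (π : U n → U n) →
    InΓ π → (∀ x → π (π x) ≡ x) → ¬ (∀ x → π x ≡ x) → FixesS π →
    (δ : V n → V n) → (∀ v → π (inj₁ v) ≡ inj₁ (δ v)) →
    (F : EdgeSet n → Bool) → OneFactorization F →
    (hΔ : ∀ d → InΔ δ d → InΦF F d) →
    Compatible F δ π hΔ ⇔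
      (∀ k N → OrbitCount (FElem F) (OrbΔ F δ) k N ⇔ OrbitCount (Fin n) (OrbΠ π) k N)
lemma4p5 n π _ π-invol π≢id π-fixesS δ π-on-RC F _ hΔ = mk⇔
  (λ (f , agrees) → conjugacy⇒sameOrbitCounts f (Agreement.agrees⇒conjugates f agrees))
  (λ same → let f , fp≡qf = sameOrbitCounts⇒conjugacy same
            in  f , Agreement.conjugates⇒agrees f fp≡qf)
  where open Setting n π π-invol π≢id π-fixesS δ π-on-RC F hΔ
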